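{- Let $k\ge 2$, $m\in\mathbb{N}$, and $n_1,\dots,n_m\in\mathbb{N}$ with $n_i\ge 2k$ for all $1\le i\le m$. Let $G=\bigcup_{i=1}^m C_{n_i}$ be the disjoint union of cycles. Then $G$ is $k$-distance magic if and only if $n_i=4k$ for every $i$, $1\le i\le m$.
   Context: All graphs are finite, simple and undirected; $d(u,v)$ is graph distance ($\infty$ between different components). For $u\in V(G)$ and $k\in\mathbb{N}$, $\partial N_k(u)=\{v\in V(G): d(u,v)=k\}$. For a graph $G$ of order $n\ge3$, a $k$-distance magic labeling ($k$-DML) is a bijection $f:V(G)\to\{1,\dots,n\}$ such that $\sum_{w\in\partial N_k(u)} f(w)$ is a constant independent of $u\in V(G)$. $G$ is $k$-distance magic ($k$-DM) if it has a $k$-DML. -}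

module Defs where

open import Data.Nat using (ℕ; zero; suc; _+_; _≤_; _≡ᵇ_)
open import Data.Fin using (Fin; zero; suc; toℕ; splitAt)
open import Data.Fin.Properties using () renaming (_≟_ to _≟F_)
open import Data.Bool using (Bool; true; false; _∧_; _∨_; not; if_then_else_)
open import Data.List using (List; map; allFin)
open import Data.Nat.ListAction using (sum)
open import Data.Bool.ListAction using (any)
open import Data.Product using (Σ; _,_; _×_; proj₁; proj₂)
open import Data.Sum using (inj₁; inj₂)
open import Function.Bundles using (_⤖_; Bijection)
open import Relation.Nullary.Decidable using (⌊_⌋)
open import Relation.Binary.PropositionalEquality using (_≡_)

Adj : ℕ → Set
Adj N = Fin N → Fin N → Bool

walk? : {N : ℕ} → Adj N → ℕ → Fin N → Fin N → Bool
walk? A zero    u v = ⌊ u ≟F v ⌋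
walk? A (suc ℓ) u v = any (λ w → A u w ∧ walk? A ℓ w v) (allFin _)

noWalkBelow : {N : ℕ} → Adj N → ℕ → Fin N → Fin N → Bool
noWalkBelow A zero    u v = true
noWalkBelow A (suc j) u v = not (walk? A j u v) ∧ noWalkBelow A j u v

-- distIs A k u v = true iff d(u,v) = k (graph distance: least length of a
-- walk; if there is no walk, d = ∞ and distIs is false for every k).
distIs : {N : ℕ} → Adj N → ℕ → Fin N → Fin N → Bool
distIs A k u v = walk? A k u v ∧ noWalkBelow A k u v

sphereSum : {N : ℕ} → Adj N → ℕ → (Fin N → ℕ) → Fin N → ℕ
sphereSum A k f u =
  sum (map (λ v → if distIs A k u v then f v else 0) (allFin _))

-- k-distance magic labeling: a bijection f : V → {1,…,N}, written as
-- f v = 1 + σ v for a bijection σ : Fin N ⤖ Fin N, such that the sum of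
-- labels over ∂N_k(u) does not depend on u.
IsKDML : {N : ℕ} → Adj N → ℕ → Fin N ⤖ Fin N → Set
IsKDML A k σ = Σ ℕ λ c → ∀ u → sphereSum A k (λ v → suc (toℕ (Bijection.to σ v))) u ≡ c

IsKDM : {N : ℕ} → Adj N → ℕ → Set
IsKDM {N} A k = 3 ≤ N × Σ (Fin N ⤖ Fin N) (IsKDML A k)

total : (m : ℕ) → (Fin m → ℕ) → ℕ
total zero    n = 0
total (suc m) n = n zero + total m (λ i → n (suc i))

-- the vertices of C_{n_1} come first, then those of C_{n_2}, etc.:
-- locate v = (i , j) means v is vertex j of cycle C_{n_i}
locate : (m : ℕ) (n : Fin m → ℕ) → Fin (total m n) → Σ (Fin m) (λ i → Fin (n i))
locate zero    n ()
locate (suc m) n v with splitAt (n zero) v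
... | inj₁ j = zero , j
... | inj₂ r with locate m (λ i → n (suc i)) r
...   | i , j = suc i , j

cycStep : ℕ → ℕ → ℕ → Bool
cycStep c a b = (b ≡ᵇ suc a) ∨ ((suc a ≡ᵇ c) ∧ (b ≡ᵇ 0))

cycAdj : ℕ → ℕ → ℕ → Bool
cycAdj c a b = cycStep c a b ∨ cycStep c b a

unionOfCycles : (m : ℕ) (n : Fin m → ℕ) → Adj (total m n)
unionOfCycles m n u v with locate m n u | locate m n v
... | i , a | i′ , b = ⌊ i ≟F i′ ⌋ ∧ cycAdj (n i) (toℕ a) (toℕ b)

-- On a cycle of length n ≥ 2k the sphere ∂N_k(u) is {u + k, u − k}, a single vertex when
-- n = 2k; then the sphere sums f (u + k) of an injective labelling cannot all agree.
-- If n > 2k, the spheres of u + k and u + 3k are {u + 2k, u} and {u + 4k, u + 2k}, so equal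
-- sphere sums give f u = f (u + 4k); injectivity makes n divide 4k, and 2k < n forces n = 4k.
-- Conversely, if every cycle has length 4k, label the first halves of the cycles with
-- 0, 1, 2, … blockwise and the second halves with N − 1, N − 2, … (N vertices in all), so
-- that antipodal vertices u and u + 2k get labels summing to N − 1; every sphere
-- {u + k, u + 3k} is such an antipodal pair.
module Submission where

open import Defs
open import Data.Bool using (true; false; T; if_then_else_; _∧_; not)
open import Data.Bool.Properties using (T-∧; T-∨)
open import Data.Fin using (Fin; zero; suc; toℕ; fromℕ<; punchOut; splitAt; _↑ˡ_; _↑ʳ_)
import Data.Fin.Properties as Fin
open import Data.Fin.Properties
  using (any?; punchOut-injective; injective⇒≤; toℕ<n; toℕ-injective; toℕ-fromℕ<;
         splitAt-↑ˡ; splitAt-↑ʳ; splitAt⁻¹-↑ˡ; splitAt⁻¹-↑ʳ)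
  renaming (_≟_ to _≟ᶠ_)
open import Data.List using (tabulate; allFin)
open import Data.List.Properties using (map-tabulate)
open import Data.List.Membership.Propositional using (lose)
open import Data.List.Membership.Propositional.Properties using (∈-allFin)
open import Data.List.Relation.Unary.Any using (satisfied)
open import Data.List.Relation.Unary.Any.Properties using (any⁺; any⁻)
open import Data.Nat
open import Data.Nat.DivMod
open import Data.Nat.ListAction using (sum)
open import Data.Nat.Properties
open import Data.Product using (Σ; ∃-syntax; _×_; _,_; proj₁; proj₂)
open import Data.Sum as Sum using (_⊎_; inj₁; inj₂)
open import Function using (_∘_; _∘₂_; id; flip)
open import Function.Bundles using (Equivalence; _⇔_; mk⇔; _⤖_; mk⤖; Bijection)
open import Function.Consequences.Propositional using (strictlySurjective⇒surjective)
open import Function.Definitions using (Injective; StrictlySurjective)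
open import Relation.Nullary using (¬_; yes; no; contradiction)
open import Relation.Nullary.Decidable using (toWitness; fromWitness)
open import Relation.Binary.PropositionalEquality

if-true : ∀ {A : Set} {b} {x y : A} → T b → (if b then x else y) ≡ x
if-true {b = true} _ = refl

if-false : ∀ {A : Set} {b} {x y : A} → ¬ T b → (if b then x else y) ≡ y
if-false {b = false} _  = refl
if-false {b = true}  ¬t = contradiction _ ¬t

T-not⁻ : ∀ {b} → T (not b) → ¬ T b
T-not⁻ {false} _ ()

T-not⁺ : ∀ {b} → ¬ T b → T (not b)
T-not⁺ {false} _  = _
T-not⁺ {true}  ¬t = ¬t _

injective⇒surjective : ∀ {N} {g : Fin N → Fin N} → Injective _≡_ _≡_ g → StrictlySurjective _≡_ g
injective⇒surjective {suc N} {g} g-injective y with any? (λ x → g x ≟ᶠ y)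
... | yes hit  = hit
... | no  miss = contradiction (injective⇒≤ avoid-y-injective) 1+n≰n
  where
  avoid-y : Fin (suc N) → Fin N
  avoid-y x = punchOut {i = y} (miss ∘ (x ,_) ∘ sym)
  avoid-y-injective : Injective _≡_ _≡_ avoid-y
  avoid-y-injective {x} {x′} =
    g-injective ∘ punchOut-injective {i = y} (miss ∘ (x ,_) ∘ sym) (miss ∘ (x′ ,_) ∘ sym)

sum-tabulate-zero : ∀ {N} (h : Fin N → ℕ) → (∀ v → h v ≡ 0) → sum (tabulate h) ≡ 0
sum-tabulate-zero {zero}  h h≡0 = refl
sum-tabulate-zero {suc N} h h≡0 = cong₂ _+_ (h≡0 zero) (sum-tabulate-zero (h ∘ suc) (h≡0 ∘ suc))

sum-tabulate-single : ∀ {N} (h : Fin N → ℕ) a → (∀ v → v ≢ a → h v ≡ 0) → sum (tabulate h) ≡ h a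
sum-tabulate-single h zero h≡0 =
  trans (cong (h zero +_) (sum-tabulate-zero (h ∘ suc) (λ v → h≡0 (suc v) λ ()))) (+-identityʳ _)
sum-tabulate-single h (suc a) h≡0 =
  cong₂ _+_ (h≡0 zero λ ())
    (sum-tabulate-single (h ∘ suc) a (λ v v≢a → h≡0 (suc v) (v≢a ∘ Fin.suc-injective)))

sum-tabulate-pair : ∀ {N} (h : Fin N → ℕ) a b → a ≢ b → (∀ v → v ≢ a → v ≢ b → h v ≡ 0) →
                    sum (tabulate h) ≡ h a + h b
sum-tabulate-pair h zero    zero    a≢b _   = contradiction refl a≢b
sum-tabulate-pair h zero    (suc b) _   h≡0 =
  cong (h zero +_)
    (sum-tabulate-single (h ∘ suc) b (λ v v≢b → h≡0 (suc v) (λ ()) (v≢b ∘ Fin.suc-injective)))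
sum-tabulate-pair h (suc a) zero    _   h≡0 =
  trans (cong (h zero +_)
          (sum-tabulate-single (h ∘ suc) a (λ v v≢a → h≡0 (suc v) (v≢a ∘ Fin.suc-injective) (λ ()))))
        (+-comm (h zero) _)
sum-tabulate-pair h (suc a) (suc b) a≢b h≡0 =
  cong₂ _+_ (h≡0 zero (λ ()) (λ ()))
    (sum-tabulate-pair (h ∘ suc) a b (a≢b ∘ cong suc)
      (λ v v≢a v≢b → h≡0 (suc v) (v≢a ∘ Fin.suc-injective) (v≢b ∘ Fin.suc-injective)))

2*m≡m+m : ∀ m → 2 * m ≡ m + m
2*m≡m+m m = cong (m +_) (+-identityʳ m)

m≤2*m : ∀ m → m ≤ 2 * m
m≤2*m m = m≤m+n m (m + 0)

m<2*m : ∀ {m} → 0 < m → m < 2 * m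
m<2*m {m} 0<m = m<m+n m (≤-trans 0<m (m≤m+n m 0))

module _ {c : ℕ} ⦃ _ : NonZero c ⦄ where

  [m%n+o]%n≡[m+o]%n : ∀ x y → (x % c + y) % c ≡ (x + y) % c
  [m%n+o]%n≡[m+o]%n x y = begin
    (x % c + y) % c         ≡⟨ %-distribˡ-+ (x % c) y c ⟩
    (x % c % c + y % c) % c ≡⟨ cong (λ z → (z + y % c) % c) (m%n%n≡m%n x c) ⟩
    (x % c + y % c) % c     ≡⟨ %-distribˡ-+ x y c ⟨
    (x + y) % c             ∎
    where open ≡-Reasoning

  -- Adding t = z * c ∸ z to both sides turns the offset z into the multiple z * c of c.
  +-cancelʳ-% : ∀ x y z → (x + z) % c ≡ (y + z) % c → x % c ≡ y % c
  +-cancelʳ-% x y z eq = begin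
    x % c                 ≡⟨ [m+kn]%n≡m%n x z c ⟨
    (x + z * c) % c       ≡⟨ cong (_% c) (pad x) ⟩
    (x + z + t) % c       ≡⟨ [m%n+o]%n≡[m+o]%n (x + z) t ⟨
    ((x + z) % c + t) % c ≡⟨ cong (λ w → (w + t) % c) eq ⟩
    ((y + z) % c + t) % c ≡⟨ [m%n+o]%n≡[m+o]%n (y + z) t ⟩
    (y + z + t) % c       ≡⟨ cong (_% c) (pad y) ⟨
    (y + z * c) % c       ≡⟨ [m+kn]%n≡m%n y z c ⟩
    y % c                 ∎
    where
    open ≡-Reasoning
    t = z * c ∸ z
    pad : ∀ w → w + z * c ≡ w + z + t
    pad w = trans (cong (w +_) (sym (m+[n∸m]≡n (m≤m*n z c)))) (sym (+-assoc w z t))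

  +-cancelˡ-% : ∀ x y z → (z + x) % c ≡ (z + y) % c → x % c ≡ y % c
  +-cancelˡ-% x y z eq =
    +-cancelʳ-% x y z (trans (cong (_% c) (+-comm x z)) (trans eq (cong (_% c) (+-comm z y))))

  m%n≡0⇒m≡n : ∀ {x} → x % c ≡ 0 → 0 < x → x < c + c → x ≡ c
  m%n≡0⇒m≡n {x} x%c≡0 0<x x<2c =
    by-quotient (x / c) (trans (m≡m%n+[m/n]*n x c) (cong (_+ (x / c) * c) x%c≡0))
    where
    by-quotient : ∀ q → x ≡ q * c → x ≡ c
    by-quotient zero          x≡0  = contradiction x≡0 (≢-sym (<⇒≢ 0<x))
    by-quotient (suc zero)    x≡c  = trans x≡c (+-identityʳ c)
    by-quotient (suc (suc q)) x≡qc =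
      contradiction (subst (c + c ≤_) (sym x≡qc) (+-monoʳ-≤ c (m≤m+n c (q * c)))) (<⇒≱ x<2c)

  cycStep⁻ : ∀ {a b} → b < c → T (cycStep c a b) → b ≡ (a + 1) % c
  cycStep⁻ {a} {b} b<c t with Equivalence.to T-∨ t
  ... | inj₁ b≡1+a = begin
    b           ≡⟨ m<n⇒m%n≡m b<c ⟨
    b % c       ≡⟨ cong (_% c) (trans (≡ᵇ⇒≡ b (suc a) b≡1+a) (+-comm 1 a)) ⟩
    (a + 1) % c ∎
    where open ≡-Reasoning
  ... | inj₂ wraps with Equivalence.to T-∧ wraps
  ...   | 1+a≡c , b≡0 = begin
    b           ≡⟨ ≡ᵇ⇒≡ b 0 b≡0 ⟩
    0           ≡⟨ n%n≡0 c ⟨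
    c % c       ≡⟨ cong (_% c) (trans (sym (≡ᵇ⇒≡ (suc a) c 1+a≡c)) (+-comm 1 a)) ⟩
    (a + 1) % c ∎
    where open ≡-Reasoning

  cycStep⁺ : ∀ {a b} → a < c → b ≡ (a + 1) % c → T (cycStep c a b)
  cycStep⁺ {a} {b} a<c b≡ with m≤n⇒m<n∨m≡n a<c
  ... | inj₁ 1+a<c = Equivalence.from T-∨ (inj₁ (≡⇒≡ᵇ b (suc a) (begin
    b           ≡⟨ b≡ ⟩
    (a + 1) % c ≡⟨ cong (_% c) (+-comm a 1) ⟩
    suc a % c   ≡⟨ m<n⇒m%n≡m 1+a<c ⟩
    suc a       ∎)))
    where open ≡-Reasoning
  ... | inj₂ 1+a≡c =
    Equivalence.from T-∨ (inj₂ (Equivalence.from T-∧ (≡⇒≡ᵇ (suc a) c 1+a≡c , ≡⇒≡ᵇ b 0 b≡0)))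
    where
    open ≡-Reasoning
    b≡0 : b ≡ 0
    b≡0 = begin
      b           ≡⟨ b≡ ⟩
      (a + 1) % c ≡⟨ cong (_% c) (trans (+-comm a 1) 1+a≡c) ⟩
      c % c       ≡⟨ n%n≡0 c ⟩
      0           ∎

total-constant : ∀ m (n : Fin m → ℕ) {c} → (∀ i → n i ≡ c) → total m n ≡ m * c
total-constant zero    n n≡c = refl
total-constant (suc m) n n≡c = cong₂ _+_ (n≡c zero) (total-constant m (n ∘ suc) (n≡c ∘ suc))

module _ {N : ℕ} (A : Adj N) where

  walk?-zero⁻ : ∀ u v → T (walk? A 0 u v) → u ≡ v
  walk?-zero⁻ u v = toWitness

  walk?-zero⁺ : ∀ u v → u ≡ v → T (walk? A 0 u v)
  walk?-zero⁺ u v = fromWitness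

  walk?-suc⁻ : ∀ ℓ u v → T (walk? A (suc ℓ) u v) → ∃[ w ] T (A u w) × T (walk? A ℓ w v)
  walk?-suc⁻ ℓ u v t with satisfied (any⁻ (λ w → A u w ∧ walk? A ℓ w v) (allFin N) t)
  ... | w , t′ = w , Equivalence.to T-∧ t′

  walk?-suc⁺ : ∀ ℓ {u v} w → T (A u w) → T (walk? A ℓ w v) → T (walk? A (suc ℓ) u v)
  walk?-suc⁺ ℓ {u} {v} w a t =
    any⁺ (λ w → A u w ∧ walk? A ℓ w v) (lose (∈-allFin w) (Equivalence.from T-∧ (a , t)))

  noWalkBelow⁻ : ∀ k {u v j} → T (noWalkBelow A k u v) → j < k → ¬ T (walk? A j u v)
  noWalkBelow⁻ (suc k) t j<1+k with Equivalence.to T-∧ t | m≤n⇒m<n∨m≡n (s≤s⁻¹ j<1+k)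
  ... | _      , t′ | inj₁ j<k  = noWalkBelow⁻ k t′ j<k
  ... | ¬walk , _  | inj₂ refl = T-not⁻ ¬walk

  noWalkBelow⁺ : ∀ k {u v} → (∀ {j} → j < k → ¬ T (walk? A j u v)) → T (noWalkBelow A k u v)
  noWalkBelow⁺ zero    _       = _
  noWalkBelow⁺ (suc k) no-walk =
    Equivalence.from T-∧ (T-not⁺ (no-walk ≤-refl) , noWalkBelow⁺ k (no-walk ∘ m<n⇒m<1+n))

unlocate : ∀ m (n : Fin m → ℕ) (i : Fin m) → Fin (n i) → Fin (total m n)
unlocate (suc m) n zero    j = j ↑ˡ total m (n ∘ suc)
unlocate (suc m) n (suc i) j = n zero ↑ʳ unlocate m (n ∘ suc) i j

locate-unlocate : ∀ m n i j → locate m n (unlocate m n i j) ≡ (i , j)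
locate-unlocate (suc m) n zero j
  rewrite splitAt-↑ˡ (n zero) j (total m (n ∘ suc)) = refl
locate-unlocate (suc m) n (suc i) j
  rewrite splitAt-↑ʳ (n zero) (total m (n ∘ suc)) (unlocate m (n ∘ suc) i j)
        | locate-unlocate m (n ∘ suc) i j = refl

unlocate-locate : ∀ m n v → unlocate m n (proj₁ (locate m n v)) (proj₂ (locate m n v)) ≡ v
unlocate-locate (suc m) n v with splitAt (n zero) v in eq
... | inj₁ j = splitAt⁻¹-↑ˡ eq
... | inj₂ r with locate m (n ∘ suc) r | unlocate-locate m (n ∘ suc) r
...   | i , j | unlocate≡r = trans (cong (n zero ↑ʳ_) unlocate≡r) (splitAt⁻¹-↑ʳ eq)

locate-injective : ∀ m n {u v} → locate m n u ≡ locate m n v → u ≡ v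
locate-injective m n {u} {v} eq = begin
  u                                                           ≡⟨ unlocate-locate m n u ⟨
  unlocate m n (proj₁ (locate m n u)) (proj₂ (locate m n u)) ≡⟨ cong (λ (i , j) → unlocate m n i j) eq ⟩
  unlocate m n (proj₁ (locate m n v)) (proj₂ (locate m n v)) ≡⟨ unlocate-locate m n v ⟩
  v                                                           ∎
  where open ≡-Reasoning

-- label i j numbers vertex j < 2d of the i-th of m cycles of length 2d: first halves
-- blockwise upwards from 0, second halves mirrored downwards from 2md − 1.
module AntipodalLabelling (m d : ℕ) ⦃ _ : NonZero d ⦄ where

  M : ℕ
  M = m * d

  block : ℕ → ℕ → ℕ
  block i r = i * d + r

  mirror : ℕ → ℕ
  mirror p = (M + M) ∸ suc p

  label : ℕ → ℕ → ℕ
  label i j = if j <ᵇ d then block i j else mirror (block i (j ∸ d))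

  label-low : ∀ i {j} → j < d → label i j ≡ block i j
  label-low i j<d = if-true (<⇒<ᵇ j<d)

  label-high : ∀ i {j} → d ≤ j → label i j ≡ mirror (block i (j ∸ d))
  label-high i {j} d≤j = if-false (λ j<ᵇd → <⇒≱ (<ᵇ⇒< j d j<ᵇd) d≤j)

  high-half : ∀ {j} → d ≤ j → j < d + d → j ∸ d < d
  high-half {j} d≤j j<2d = subst (j ∸ d <_) (m+n∸n≡m d d) (∸-monoˡ-< j<2d d≤j)

  block<M : ∀ {i r} → i < m → r < d → block i r < M
  block<M {i} {r} i<m r<d = begin-strict
    i * d + r   <⟨ +-monoʳ-< (i * d) r<d ⟩
    i * d + d   ≡⟨ +-comm (i * d) d ⟩
    suc i * d   ≤⟨ *-monoˡ-≤ d i<m ⟩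
    m * d       ∎
    where open ≤-Reasoning

  block-injective : ∀ {i i′ r r′} → r < d → r′ < d → block i r ≡ block i′ r′ → i ≡ i′ × r ≡ r′
  block-injective {i} {i′} {r} {r′} r<d r′<d eq =
    *-cancelʳ-≡ i i′ d (+-cancelʳ-≡ r (i * d) (i′ * d) (trans eq (cong (i′ * d +_) (sym r≡r′)))) , r≡r′
    where
    open ≡-Reasoning
    r≡r′ : r ≡ r′
    r≡r′ = begin
      r                 ≡⟨ m<n⇒m%n≡m r<d ⟨
      r % d             ≡⟨ [m+kn]%n≡m%n r i d ⟨
      (r + i * d) % d   ≡⟨ cong (_% d) (trans (+-comm r (i * d)) (trans eq (+-comm (i′ * d) r′))) ⟩
      (r′ + i′ * d) % d ≡⟨ [m+kn]%n≡m%n r′ i′ d ⟩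
      r′ % d            ≡⟨ m<n⇒m%n≡m r′<d ⟩
      r′                ∎

  M≤mirror : ∀ {p} → p < M → M ≤ mirror p
  M≤mirror {p} p<M = begin
    M             ≡⟨ m+n∸n≡m M M ⟨
    M + M ∸ M     ≤⟨ ∸-monoʳ-≤ (M + M) p<M ⟩
    M + M ∸ suc p ∎
    where open ≤-Reasoning

  mirror-injective : ∀ {p p′} → p < M → p′ < M → mirror p ≡ mirror p′ → p ≡ p′
  mirror-injective p<M p′<M =
    suc-injective ∘ ∸-cancelˡ-≡ (≤-trans p<M (m≤m+n M M)) (≤-trans p′<M (m≤m+n M M))

  label<M+M : ∀ {i j} → i < m → j < d + d → label i j < M + M
  label<M+M {i} {j} i<m j<2d with j <? d
  ... | yes j<d = subst (_< M + M) (sym (label-low i j<d)) (<-≤-trans (block<M i<m j<d) (m≤m+n M M))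
  ... | no  j≮d = subst (_< M + M) (sym (label-high i (≮⇒≥ j≮d)))
                    (∸-monoʳ-< z<s (≤-trans (block<M i<m (high-half (≮⇒≥ j≮d) j<2d)) (m≤m+n M M)))

  low≢high : ∀ {i i′ j j′} → i < m → i′ < m → j < d → d ≤ j′ → j′ < d + d →
             label i j ≢ label i′ j′
  low≢high {i} {i′} i<m i′<m j<d d≤j′ j′<2d eq =
    <⇒≢ (<-≤-trans (block<M i<m j<d) (M≤mirror (block<M i′<m (high-half d≤j′ j′<2d))))
        (trans (sym (label-low i j<d)) (trans eq (label-high i′ d≤j′)))

  high-injective : ∀ {i i′ j j′} → i < m → i′ < m → d ≤ j → d ≤ j′ → j < d + d → j′ < d + d →
                   label i j ≡ label i′ j′ → i ≡ i′ × j ≡ j′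
  high-injective {i} {i′} {j} {j′} i<m i′<m d≤j d≤j′ j<2d j′<2d eq
    with block-injective (high-half d≤j j<2d) (high-half d≤j′ j′<2d)
           (mirror-injective (block<M i<m (high-half d≤j j<2d)) (block<M i′<m (high-half d≤j′ j′<2d))
             (trans (sym (label-high i d≤j)) (trans eq (label-high i′ d≤j′))))
  ... | i≡i′ , j∸d≡j′∸d =
    i≡i′ , trans (sym (m∸n+n≡m d≤j)) (trans (cong (_+ d) j∸d≡j′∸d) (m∸n+n≡m d≤j′))

  label-injective : ∀ {i i′ j j′} → i < m → i′ < m → j < d + d → j′ < d + d →
                    label i j ≡ label i′ j′ → i ≡ i′ × j ≡ j′
  label-injective {i} {i′} {j} {j′} i<m i′<m j<2d j′<2d eq with j <? d | j′ <? d
  ... | yes j<d | yes j′<d =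
    block-injective j<d j′<d (trans (sym (label-low i j<d)) (trans eq (label-low i′ j′<d)))
  ... | yes j<d | no  j′≮d = contradiction eq (low≢high i<m i′<m j<d (≮⇒≥ j′≮d) j′<2d)
  ... | no  j≮d | yes j′<d = contradiction (sym eq) (low≢high i′<m i<m j′<d (≮⇒≥ j≮d) j<2d)
  ... | no  j≮d | no  j′≮d = high-injective i<m i′<m (≮⇒≥ j≮d) (≮⇒≥ j′≮d) j<2d j′<2d eq

  label-antipodal : ∀ {i j} → i < m → j < d → label i j + label i (j + d) ≡ pred (M + M)
  label-antipodal {i} {j} i<m j<d = begin
    label i j + label i (j + d)              ≡⟨ cong₂ _+_ (label-low i j<d) (label-high i (m≤n+m d j)) ⟩
    block i j + mirror (block i (j + d ∸ d)) ≡⟨ cong (λ r → block i j + mirror (block i r)) (m+n∸n≡m j d) ⟩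
    block i j + mirror (block i j)           ≡⟨ cong pred (m+[n∸m]≡n (≤-trans (block<M i<m j<d) (m≤m+n M M))) ⟩
    pred (M + M)                             ∎
    where open ≡-Reasoning

module UnionOfCycles (m : ℕ) (n : Fin m → ℕ) ⦃ n≢0 : ∀ {i} → NonZero (n i) ⦄ where

  V : Set
  V = Fin (total m n)

  G : Adj (total m n)
  G = unionOfCycles m n

  cycle : V → Fin m
  cycle u = proj₁ (locate m n u)

  position : V → ℕ
  position u = toℕ (proj₂ (locate m n u))

  n>0 : ∀ i → 0 < n i
  n>0 i = >-nonZero⁻¹ (n i)

  position<n : ∀ u → position u < n (cycle u)
  position<n u = toℕ<n (proj₂ (locate m n u))

  position<n-of : ∀ {u w} → cycle w ≡ cycle u → position w < n (cycle u)
  position<n-of {w = w} cw≡cu = subst (λ i → position w < n i) cw≡cu (position<n w)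

  %-cong-cycle : ∀ {u v} x → cycle u ≡ cycle v → x % n (cycle u) ≡ x % n (cycle v)
  %-cong-cycle x cu≡cv = cong (λ i → x % n i) cu≡cv

  vertex-≡ : ∀ {u v} → cycle u ≡ cycle v → position u ≡ position v → u ≡ v
  vertex-≡ {u} {v} = locate-injective m n ∘₂ Σ-≡ (locate m n u) (locate m n v)
    where
    Σ-≡ : ∀ (p q : Σ (Fin m) (Fin ∘ n)) → proj₁ p ≡ proj₁ q → toℕ (proj₂ p) ≡ toℕ (proj₂ q) →
          p ≡ q
    Σ-≡ (i , a) (.i , b) refl a≡b = cong (i ,_) (toℕ-injective a≡b)

  vertex : Fin m → ℕ → V
  vertex i x = unlocate m n i (fromℕ< (m%n<n x (n i)))

  cycle-vertex : ∀ i x → cycle (vertex i x) ≡ i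
  cycle-vertex i x = cong proj₁ (locate-unlocate m n i _)

  position-vertex : ∀ i x → position (vertex i x) ≡ x % n i
  position-vertex i x = trans (cong (toℕ ∘ proj₂) (locate-unlocate m n i _)) (toℕ-fromℕ< _)

  infixl 6 _⊕_ _⊖_

  _⊕_ : V → ℕ → V
  u ⊕ s = vertex (cycle u) (position u + s)

  cycle-⊕ : ∀ u s → cycle (u ⊕ s) ≡ cycle u
  cycle-⊕ u s = cycle-vertex (cycle u) _

  length-⊕ : ∀ u s → n (cycle (u ⊕ s)) ≡ n (cycle u)
  length-⊕ u s = cong n (cycle-⊕ u s)

  position-⊕ : ∀ u s → position (u ⊕ s) ≡ (position u + s) % n (cycle u)
  position-⊕ u s = position-vertex (cycle u) _

  ≡⊕⁻ : ∀ {u v s} → v ≡ u ⊕ s → cycle v ≡ cycle u × position v ≡ (position u + s) % n (cycle u)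
  ≡⊕⁻ {u} {s = s} refl = cycle-⊕ u s , position-⊕ u s

  ≡⊕⁺ : ∀ {u v s} → cycle v ≡ cycle u → position v ≡ (position u + s) % n (cycle u) → v ≡ u ⊕ s
  ≡⊕⁺ {u} {s = s} cv≡cu pv≡ =
    vertex-≡ (trans cv≡cu (sym (cycle-⊕ u s))) (trans pv≡ (sym (position-⊕ u s)))

  ⊕-identityʳ : ∀ u → u ⊕ 0 ≡ u
  ⊕-identityʳ u = sym (≡⊕⁺ refl (begin
    position u                     ≡⟨ m<n⇒m%n≡m (position<n u) ⟨
    position u % n (cycle u)       ≡⟨ cong (_% n (cycle u)) (+-identityʳ _) ⟨
    (position u + 0) % n (cycle u) ∎))
    where open ≡-Reasoning

  ⊕-period : ∀ u → u ⊕ n (cycle u) ≡ u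
  ⊕-period u = sym (≡⊕⁺ refl (begin
    position u                               ≡⟨ m<n⇒m%n≡m (position<n u) ⟨
    position u % n (cycle u)                 ≡⟨ [m+n]%n≡m%n (position u) (n (cycle u)) ⟨
    (position u + n (cycle u)) % n (cycle u) ∎))
    where open ≡-Reasoning

  ⊕-assoc : ∀ u s t → u ⊕ s ⊕ t ≡ u ⊕ (s + t)
  ⊕-assoc u s t = ≡⊕⁺ (trans (cycle-⊕ (u ⊕ s) t) (cycle-⊕ u s)) (begin
    position (u ⊕ s ⊕ t)                               ≡⟨ position-⊕ (u ⊕ s) t ⟩
    (position (u ⊕ s) + t) % n (cycle (u ⊕ s))         ≡⟨ %-cong-cycle _ (cycle-⊕ u s) ⟩
    (position (u ⊕ s) + t) % n (cycle u)               ≡⟨ cong (λ x → (x + t) % n (cycle u)) (position-⊕ u s) ⟩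
    ((position u + s) % n (cycle u) + t) % n (cycle u) ≡⟨ [m%n+o]%n≡[m+o]%n (position u + s) t ⟩
    (position u + s + t) % n (cycle u)                 ≡⟨ cong (_% n (cycle u)) (+-assoc (position u) s t) ⟩
    (position u + (s + t)) % n (cycle u)               ∎)
    where open ≡-Reasoning

  ⊕-cancelʳ : ∀ {u v} s → u ⊕ s ≡ v ⊕ s → u ≡ v
  ⊕-cancelʳ {u} {v} s eq = vertex-≡ cu≡cv (begin
    position u               ≡⟨ m<n⇒m%n≡m (position<n u) ⟨
    position u % n (cycle u) ≡⟨ +-cancelʳ-% (position u) (position v) s shifted ⟩
    position v % n (cycle u) ≡⟨ %-cong-cycle (position v) cu≡cv ⟩
    position v % n (cycle v) ≡⟨ m<n⇒m%n≡m (position<n v) ⟩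
    position v               ∎)
    where
    open ≡-Reasoning
    cu≡cv : cycle u ≡ cycle v
    cu≡cv = trans (sym (cycle-⊕ u s)) (trans (cong cycle eq) (cycle-⊕ v s))
    shifted : (position u + s) % n (cycle u) ≡ (position v + s) % n (cycle u)
    shifted = begin
      (position u + s) % n (cycle u) ≡⟨ position-⊕ u s ⟨
      position (u ⊕ s)               ≡⟨ cong position eq ⟩
      position (v ⊕ s)               ≡⟨ position-⊕ v s ⟩
      (position v + s) % n (cycle v) ≡⟨ %-cong-cycle _ cu≡cv ⟨
      (position v + s) % n (cycle u) ∎

  ⊕-injective-% : ∀ u {s t} → u ⊕ s ≡ u ⊕ t → s % n (cycle u) ≡ t % n (cycle u)
  ⊕-injective-% u {s} {t} eq = +-cancelˡ-% s t (position u)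
    (trans (sym (position-⊕ u s)) (trans (cong position eq) (position-⊕ u t)))

  ⊕-injectiveʳ : ∀ u {s t} → u ⊕ s ≡ u ⊕ t → s < n (cycle u) → t < n (cycle u) → s ≡ t
  ⊕-injectiveʳ u {s} {t} eq s<n t<n =
    trans (sym (m<n⇒m%n≡m s<n)) (trans (⊕-injective-% u eq) (m<n⇒m%n≡m t<n))

  _⊖_ : V → ℕ → V
  u ⊖ s = u ⊕ (n (cycle u) ∸ s)

  ⊖-⊕ : ∀ u {s} → s ≤ n (cycle u) → u ⊖ s ⊕ s ≡ u
  ⊖-⊕ u {s} s≤n = trans (⊕-assoc u _ s) (trans (cong (u ⊕_) (m∸n+n≡m s≤n)) (⊕-period u))

  ⊕-⊖ : ∀ u {s} → s ≤ n (cycle u) → u ⊕ s ⊖ s ≡ u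
  ⊕-⊖ u {s} s≤n = begin
    u ⊕ s ⊕ (n (cycle (u ⊕ s)) ∸ s) ≡⟨ cong (λ l → u ⊕ s ⊕ (l ∸ s)) (length-⊕ u s) ⟩
    u ⊕ s ⊕ (n (cycle u) ∸ s)       ≡⟨ ⊕-assoc u s _ ⟩
    u ⊕ (s + (n (cycle u) ∸ s))     ≡⟨ cong (u ⊕_) (m+[n∸m]≡n s≤n) ⟩
    u ⊕ n (cycle u)                 ≡⟨ ⊕-period u ⟩
    u                               ∎
    where open ≡-Reasoning

  ⊕≢⊖ : ∀ u {k} → 0 < k → 2 * k < n (cycle u) → u ⊕ k ≢ u ⊖ k
  ⊕≢⊖ u {k} 0<k 2k<n eq = <⇒≢ 2k<n (begin
    2 * k                 ≡⟨ 2*m≡m+m k ⟩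
    k + k                 ≡⟨ cong (k +_) (⊕-injectiveʳ u eq k<n (∸-monoʳ-< 0<k (<⇒≤ k<n))) ⟩
    k + (n (cycle u) ∸ k) ≡⟨ m+[n∸m]≡n (<⇒≤ k<n) ⟩
    n (cycle u)           ∎)
    where
    open ≡-Reasoning
    k<n : k < n (cycle u)
    k<n = ≤-<-trans (m≤2*m k) 2k<n

  ⊕≡⊖ : ∀ u {k} → 2 * k ≡ n (cycle u) → u ⊕ k ≡ u ⊖ k
  ⊕≡⊖ u {k} 2k≡n = cong (u ⊕_) (begin
    k               ≡⟨ m+n∸n≡m k k ⟨
    k + k ∸ k       ≡⟨ cong (_∸ k) (trans (sym (2*m≡m+m k)) 2k≡n) ⟩
    n (cycle u) ∸ k ∎)
    where open ≡-Reasoning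

  -- Distances in the union of cycles

  Apart : ℕ → V → V → Set
  Apart s u v = v ≡ u ⊕ s ⊎ u ≡ v ⊕ s

  cycAdj⇒adjacent : ∀ {u w} → cycle u ≡ cycle w → T (cycAdj (n (cycle u)) (position u) (position w)) →
                    T (G u w)
  cycAdj⇒adjacent cu≡cw t = Equivalence.from T-∧ (fromWitness cu≡cw , t)

  adjacent⁻ : ∀ {u w} → T (G u w) → Apart 1 u w
  adjacent⁻ {u} {w} t with Equivalence.to T-∧ t
  ... | same-cycle , steps with toWitness same-cycle | Equivalence.to T-∨ steps
  ...   | cu≡cw | inj₁ forward  =
    inj₁ (≡⊕⁺ (sym cu≡cw) (cycStep⁻ (position<n-of (sym cu≡cw)) forward))
  ...   | cu≡cw | inj₂ backward =
    inj₂ (≡⊕⁺ cu≡cw (trans (cycStep⁻ (position<n u) backward) (%-cong-cycle _ cu≡cw)))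

  adjacent⁺ : ∀ {u w} → Apart 1 u w → T (G u w)
  adjacent⁺ {u} {w} (inj₁ w≡u⊕1) with ≡⊕⁻ w≡u⊕1
  ... | cw≡cu , pw≡ = cycAdj⇒adjacent (sym cw≡cu)
    (Equivalence.from (T-∨ {cycStep (n (cycle u)) (position u) (position w)})
      (inj₁ (cycStep⁺ (position<n u) pw≡)))
  adjacent⁺ {u} {w} (inj₂ u≡w⊕1) with ≡⊕⁻ u≡w⊕1
  ... | cu≡cw , pu≡ = cycAdj⇒adjacent cu≡cw
    (Equivalence.from (T-∨ {cycStep (n (cycle u)) (position u) (position w)})
      (inj₂ (cycStep⁺ (position<n-of (sym cu≡cw)) (trans pu≡ (%-cong-cycle _ (sym cu≡cw))))))

  apart-zero : ∀ {u v} → Apart 0 u v → u ≡ v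
  apart-zero {u}     (inj₁ v≡u⊕0) = sym (trans v≡u⊕0 (⊕-identityʳ u))
  apart-zero {v = v} (inj₂ u≡v⊕0) = trans u≡v⊕0 (⊕-identityʳ v)

  apart-split : ∀ {s u v} → Apart (suc s) u v → ∃[ w ] Apart 1 u w × Apart s w v
  apart-split {s} {u} (inj₁ v≡u⊕1+s) =
    u ⊕ 1 , inj₁ refl , inj₁ (trans v≡u⊕1+s (sym (⊕-assoc u 1 s)))
  apart-split {s} {v = v} (inj₂ u≡v⊕1+s) =
    v ⊕ s , inj₂ (trans u≡v⊕1+s (trans (cong (v ⊕_) (+-comm 1 s)) (sym (⊕-assoc v s 1)))) , inj₂ refl

  apart-join : ∀ {s u w v} → Apart 1 u w → Apart s w v → ∃[ s′ ] s′ ≤ suc s × Apart s′ u v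
  apart-join {s} {u} (inj₁ refl) (inj₁ refl) = suc s , ≤-refl , inj₁ (⊕-assoc u 1 s)
  apart-join {zero} (inj₁ refl) (inj₂ u⊕1≡v⊕0) =
    1 , ≤-refl , inj₁ (trans (sym (⊕-identityʳ _)) (sym u⊕1≡v⊕0))
  apart-join {suc s} {v = v} (inj₁ refl) (inj₂ u⊕1≡v⊕1+s) =
    s , m≤n⇒m≤1+n (n≤1+n s) ,
    inj₂ (⊕-cancelʳ 1 (trans u⊕1≡v⊕1+s (trans (cong (v ⊕_) (+-comm 1 s)) (sym (⊕-assoc v s 1)))))
  apart-join {zero} {w = w} (inj₂ refl) (inj₁ v≡w⊕0) =
    1 , ≤-refl , inj₂ (cong (_⊕ 1) (trans (sym (⊕-identityʳ w)) (sym v≡w⊕0)))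
  apart-join {suc s} {w = w} (inj₂ refl) (inj₁ refl) =
    s , m≤n⇒m≤1+n (n≤1+n s) , inj₁ (sym (⊕-assoc w 1 s))
  apart-join {s} {v = v} (inj₂ refl) (inj₂ refl) =
    suc s , ≤-refl , inj₂ (trans (⊕-assoc v s 1) (cong (v ⊕_) (+-comm s 1)))

  walk⇒apart : ∀ ℓ {u v} → T (walk? G ℓ u v) → ∃[ s ] s ≤ ℓ × Apart s u v
  walk⇒apart zero {u} {v} walk with walk?-zero⁻ G u v walk
  ... | refl = 0 , z≤n , inj₁ (sym (⊕-identityʳ u))
  walk⇒apart (suc ℓ) {u} {v} walk with walk?-suc⁻ G ℓ u v walk
  ... | w , adjacent , walk′ with walk⇒apart ℓ walk′
  ...   | s , s≤ℓ , w-apart-v with apart-join (adjacent⁻ adjacent) w-apart-v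
  ...     | s′ , s′≤1+s , u-apart-v = s′ , ≤-trans s′≤1+s (s≤s s≤ℓ) , u-apart-v

  apart⇒walk : ∀ s {u v} → Apart s u v → T (walk? G s u v)
  apart⇒walk zero    {u} {v} u-apart-v = walk?-zero⁺ G u v (apart-zero u-apart-v)
  apart⇒walk (suc s) u-apart-v with apart-split u-apart-v
  ... | w , u-apart-w , w-apart-v = walk?-suc⁺ G s w (adjacent⁺ u-apart-w) (apart⇒walk s w-apart-v)

  -- Both s and s + k lie strictly between 0 and the length of the cycle.
  ahead-shortest : ∀ {s k u v} → 0 < k → 2 * k ≤ n (cycle u) → s < k → v ≡ u ⊕ s → ¬ Apart k u v
  ahead-shortest {s} {k} {u} 0<k 2k≤n s<k v≡u⊕s (inj₁ v≡u⊕k) =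
    <⇒≢ s<k (⊕-injectiveʳ u (trans (sym v≡u⊕s) v≡u⊕k) (<-trans s<k k<n) k<n)
    where
    k<n : k < n (cycle u)
    k<n = <-≤-trans (m<2*m 0<k) 2k≤n
  ahead-shortest {s} {k} {u} 0<k 2k≤n s<k refl (inj₂ u≡u⊕s⊕k) =
    m<n⇒n≢0 (<-≤-trans 0<k (m≤n+m k s)) (sym (⊕-injectiveʳ u u⊕0≡u⊕[s+k] (n>0 (cycle u)) s+k<n))
    where
    u⊕0≡u⊕[s+k] : u ⊕ 0 ≡ u ⊕ (s + k)
    u⊕0≡u⊕[s+k] = trans (⊕-identityʳ u) (trans u≡u⊕s⊕k (⊕-assoc u s k))
    s+k<n : s + k < n (cycle u)
    s+k<n = <-≤-trans (+-monoˡ-< k s<k) (≤-trans (≤-reflexive (sym (2*m≡m+m k))) 2k≤n)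

  apart-shortest : ∀ {s k u v} → 0 < k → 2 * k ≤ n (cycle u) → s < k → Apart s u v → ¬ Apart k u v
  apart-shortest 0<k 2k≤n s<k (inj₁ v≡u⊕s) = ahead-shortest 0<k 2k≤n s<k v≡u⊕s
  apart-shortest {s} {k} {v = v} 0<k 2k≤n s<k (inj₂ refl) =
    ahead-shortest 0<k (subst (2 * k ≤_) (length-⊕ v s) 2k≤n) s<k refl ∘ Sum.swap

  distIs⁻ : ∀ {k u v} → 0 < k → 2 * k ≤ n (cycle u) → T (distIs G k u v) → Apart k u v
  distIs⁻ {k} 0<k 2k≤n t with Equivalence.to T-∧ t
  ... | walk , no-shorter with walk⇒apart k walk
  ...   | s , s≤k , u-apart-v with m≤n⇒m<n∨m≡n s≤k
  ...     | inj₁ s<k  = contradiction (apart⇒walk s u-apart-v) (noWalkBelow⁻ G k no-shorter s<k)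
  ...     | inj₂ refl = u-apart-v

  distIs⁺ : ∀ {k u v} → 0 < k → 2 * k ≤ n (cycle u) → Apart k u v → T (distIs G k u v)
  distIs⁺ {k} 0<k 2k≤n u-apart-v =
    Equivalence.from T-∧ (apart⇒walk k u-apart-v , noWalkBelow⁺ G k no-shorter)
    where
    no-shorter : ∀ {j} → j < k → ¬ T (walk? G j _ _)
    no-shorter {j} j<k walk with walk⇒apart j walk
    ... | s , s≤j , u-apart-v′ = apart-shortest 0<k 2k≤n (≤-<-trans s≤j j<k) u-apart-v′ u-apart-v

  apart⇒sphere : ∀ {k u v} → k ≤ n (cycle u) → Apart k u v → v ≡ u ⊕ k ⊎ v ≡ u ⊖ k
  apart⇒sphere k≤n (inj₁ v≡u⊕k) = inj₁ v≡u⊕k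
  apart⇒sphere {k} {v = v} k≤n (inj₂ refl) = inj₂ (sym (⊕-⊖ v (subst (k ≤_) (length-⊕ v k) k≤n)))

  sphere⇒apart : ∀ {k u v} → k ≤ n (cycle u) → v ≡ u ⊕ k ⊎ v ≡ u ⊖ k → Apart k u v
  sphere⇒apart k≤n         (inj₁ v≡u⊕k) = inj₁ v≡u⊕k
  sphere⇒apart {u = u} k≤n (inj₂ refl)  = inj₂ (sym (⊖-⊕ u k≤n))

  module _ {k u} (0<k : 0 < k) (2k≤n : 2 * k ≤ n (cycle u)) (f : V → ℕ) where

    private
      term : V → ℕ
      term v = if distIs G k u v then f v else 0

      k≤n : k ≤ n (cycle u)
      k≤n = ≤-trans (m≤2*m k) 2k≤n

      term-inside : ∀ {v} → v ≡ u ⊕ k ⊎ v ≡ u ⊖ k → term v ≡ f v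
      term-inside on-sphere = if-true (distIs⁺ 0<k 2k≤n (sphere⇒apart k≤n on-sphere))

      term-outside : ∀ v → v ≢ u ⊕ k → v ≢ u ⊖ k → term v ≡ 0
      term-outside v v≢u⊕k v≢u⊖k =
        if-false (Sum.[ v≢u⊕k , v≢u⊖k ] ∘ apart⇒sphere k≤n ∘ distIs⁻ 0<k 2k≤n)

      sphereSum≡ : sphereSum G k f u ≡ sum (tabulate term)
      sphereSum≡ = cong sum (map-tabulate id term)

    sphereSum-pair : u ⊕ k ≢ u ⊖ k → sphereSum G k f u ≡ f (u ⊕ k) + f (u ⊖ k)
    sphereSum-pair u⊕k≢u⊖k = trans sphereSum≡ (trans
      (sum-tabulate-pair term (u ⊕ k) (u ⊖ k) u⊕k≢u⊖k term-outside)
      (cong₂ _+_ (term-inside (inj₁ refl)) (term-inside (inj₂ refl))))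

    sphereSum-single : u ⊕ k ≡ u ⊖ k → sphereSum G k f u ≡ f (u ⊕ k)
    sphereSum-single u⊕k≡u⊖k = trans sphereSum≡ (trans
      (sum-tabulate-single term (u ⊕ k)
        (λ v v≢u⊕k → term-outside v v≢u⊕k (v≢u⊕k ∘ flip trans (sym u⊕k≡u⊖k))))
      (term-inside (inj₁ refl)))

  -- Constant sphere sums of an injective labelling force cycles of length 4k

  module _ {k c} (0<k : 0 < k) (f : V → ℕ) (f-injective : Injective _≡_ _≡_ f)
           (constant : ∀ u → sphereSum G k f u ≡ c) where

    magic⇒n≢2k : ∀ u → 2 * k ≢ n (cycle u)
    magic⇒n≢2k u 2k≡n = 0≢1+n (⊕-injectiveʳ u u⊕0≡u⊕1 (n>0 (cycle u)) 1<n)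
      where
      sphere-value : ∀ w → 2 * k ≡ n (cycle w) → f (w ⊕ k) ≡ c
      sphere-value w 2k≡n =
        trans (sym (sphereSum-single 0<k (≤-reflexive 2k≡n) f (⊕≡⊖ w 2k≡n))) (constant w)
      u⊕0≡u⊕1 : u ⊕ 0 ≡ u ⊕ 1
      u⊕0≡u⊕1 = trans (⊕-identityʳ u) (⊕-cancelʳ k (f-injective (trans
        (sphere-value u 2k≡n) (sym (sphere-value (u ⊕ 1) (trans 2k≡n (sym (length-⊕ u 1))))))))
      1<n : 1 < n (cycle u)
      1<n = ≤-trans (*-monoʳ-≤ 2 0<k) (≤-reflexive 2k≡n)

    antipodal-sum : ∀ u → 2 * k < n (cycle u) → f (u ⊕ 2 * k) + f u ≡ c
    antipodal-sum u 2k<n = begin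
      f (u ⊕ 2 * k) + f u           ≡⟨ cong₂ _+_ (cong f u⊕2k≡u⊕k⊕k) (cong f (sym (⊕-⊖ u k≤n))) ⟩
      f (u ⊕ k ⊕ k) + f (u ⊕ k ⊖ k) ≡⟨ sphereSum-pair 0<k (<⇒≤ 2k<n′) f (⊕≢⊖ (u ⊕ k) 0<k 2k<n′) ⟨
      sphereSum G k f (u ⊕ k)       ≡⟨ constant (u ⊕ k) ⟩
      c                             ∎
      where
      open ≡-Reasoning
      k≤n : k ≤ n (cycle u)
      k≤n = ≤-trans (m≤2*m k) (<⇒≤ 2k<n)
      2k<n′ : 2 * k < n (cycle (u ⊕ k))
      2k<n′ = subst (2 * k <_) (sym (length-⊕ u k)) 2k<n
      u⊕2k≡u⊕k⊕k : u ⊕ 2 * k ≡ u ⊕ k ⊕ k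
      u⊕2k≡u⊕k⊕k = trans (cong (u ⊕_) (2*m≡m+m k)) (sym (⊕-assoc u k k))

    magic-2k<n⇒n≡4k : ∀ u → 2 * k < n (cycle u) → n (cycle u) ≡ 4 * k
    magic-2k<n⇒n≡4k u 2k<n = sym (begin
      4 * k         ≡⟨ *-distribʳ-+ k 2 2 ⟩
      2 * k + 2 * k ≡⟨ m%n≡0⇒m≡n 4k%n≡0 0<4k (+-mono-< 2k<n 2k<n) ⟩
      n (cycle u)   ∎)
      where
      open ≡-Reasoning
      w = u ⊕ 2 * k
      f-periodic : f u ≡ f (w ⊕ 2 * k)
      f-periodic = +-cancelˡ-≡ (f w) _ _ (begin
        f w + f u           ≡⟨ antipodal-sum u 2k<n ⟩
        c                   ≡⟨ antipodal-sum w (subst (2 * k <_) (sym (length-⊕ u (2 * k))) 2k<n) ⟨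
        f (w ⊕ 2 * k) + f w ≡⟨ +-comm (f (w ⊕ 2 * k)) (f w) ⟩
        f w + f (w ⊕ 2 * k) ∎)
      u⊕0≡u⊕4k : u ⊕ 0 ≡ u ⊕ (2 * k + 2 * k)
      u⊕0≡u⊕4k = trans (⊕-identityʳ u) (trans (f-injective f-periodic) (⊕-assoc u (2 * k) (2 * k)))
      0<4k : 0 < 2 * k + 2 * k
      0<4k = <-≤-trans 0<k (≤-trans (m≤2*m k) (m≤m+n _ _))
      4k%n≡0 : (2 * k + 2 * k) % n (cycle u) ≡ 0
      4k%n≡0 = trans (sym (⊕-injective-% u u⊕0≡u⊕4k)) (m<n⇒m%n≡m (n>0 (cycle u)))

    magic⇒n≡4k : ∀ u → 2 * k ≤ n (cycle u) → n (cycle u) ≡ 4 * k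
    magic⇒n≡4k u 2k≤n with m≤n⇒m<n∨m≡n 2k≤n
    ... | inj₁ 2k<n = magic-2k<n⇒n≡4k u 2k<n
    ... | inj₂ 2k≡n = contradiction 2k≡n (magic⇒n≢2k u)

  isKDM⇒n≡4k : ∀ {k} → 0 < k → IsKDM G k → ∀ i → 2 * k ≤ n i → n i ≡ 4 * k
  isKDM⇒n≡4k {k} 0<k (_ , σ , _ , constant) i 2k≤n =
    subst (λ j → n j ≡ 4 * k) (cycle-vertex i 0)
      (magic⇒n≡4k 0<k f f-injective constant (vertex i 0)
        (subst (λ j → 2 * k ≤ n j) (sym (cycle-vertex i 0)) 2k≤n))
    where
    f : V → ℕ
    f v = suc (toℕ (Bijection.to σ v))
    f-injective : Injective _≡_ _≡_ f
    f-injective = Bijection.injective σ ∘ toℕ-injective ∘ suc-injective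

  -- A magic labelling of cycles of length 4k

  module _ {k} (0<k : 0 < k) (n≡4k : ∀ i → n i ≡ 4 * k) where

    private
      d : ℕ
      d = 2 * k

      instance
        d≢0 : NonZero d
        d≢0 = >-nonZero (*-monoʳ-< 2 0<k)

      n≡d+d : ∀ i → n i ≡ d + d
      n≡d+d i = trans (n≡4k i) (*-distribʳ-+ k 2 2)

      position<d+d : ∀ u → position u < d + d
      position<d+d u = subst (position u <_) (n≡d+d (cycle u)) (position<n u)

    open AntipodalLabelling m d

    total≡M+M : total m n ≡ M + M
    total≡M+M = trans (total-constant m n n≡d+d) (*-distribˡ-+ m d d)

    vertexLabel : V → ℕ
    vertexLabel v = label (toℕ (cycle v)) (position v)

    vertexLabel< : ∀ v → vertexLabel v < total m n
    vertexLabel< v =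
      subst (vertexLabel v <_) (sym total≡M+M) (label<M+M (toℕ<n (cycle v)) (position<d+d v))

    vertexLabel-injective : Injective _≡_ _≡_ vertexLabel
    vertexLabel-injective {v} {w} eq
      with label-injective (toℕ<n (cycle v)) (toℕ<n (cycle w)) (position<d+d v) (position<d+d w) eq
    ... | cv≡cw , pv≡pw = vertex-≡ (toℕ-injective cv≡cw) pv≡pw

    ⊕-d-d : ∀ w → w ⊕ d ⊕ d ≡ w
    ⊕-d-d w = trans (⊕-assoc w d d) (trans (cong (w ⊕_) (sym (n≡d+d (cycle w)))) (⊕-period w))

    position-⊕-low : ∀ w → position w < d → position (w ⊕ d) ≡ position w + d
    position-⊕-low w pw<d = trans (position-⊕ w d)
      (m<n⇒m%n≡m (subst (position w + d <_) (sym (n≡d+d (cycle w))) (+-monoˡ-< d pw<d)))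

    position-⊕-high : ∀ w → d ≤ position w → position (w ⊕ d) ≡ position w ∸ d
    position-⊕-high w d≤pw = begin
      position (w ⊕ d)                             ≡⟨ position-⊕ w d ⟩
      (position w + d) % n (cycle w)               ≡⟨ cong (_% n (cycle w)) pw+d≡ ⟩
      (position w ∸ d + n (cycle w)) % n (cycle w) ≡⟨ [m+n]%n≡m%n (position w ∸ d) (n (cycle w)) ⟩
      (position w ∸ d) % n (cycle w)               ≡⟨ m<n⇒m%n≡m (≤-<-trans (m∸n≤m _ d) (position<n w)) ⟩
      position w ∸ d                               ∎
      where
      open ≡-Reasoning
      pw+d≡ : position w + d ≡ position w ∸ d + n (cycle w)
      pw+d≡ = begin
        position w + d               ≡⟨ cong (_+ d) (m∸n+n≡m d≤pw) ⟨
        position w ∸ d + d + d       ≡⟨ +-assoc (position w ∸ d) d d ⟩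
        position w ∸ d + (d + d)     ≡⟨ cong (position w ∸ d +_) (n≡d+d (cycle w)) ⟨
        position w ∸ d + n (cycle w) ∎

    antipodal-low : ∀ w → position w < d → vertexLabel w + vertexLabel (w ⊕ d) ≡ pred (M + M)
    antipodal-low w pw<d = begin
      vertexLabel w + vertexLabel (w ⊕ d)                     ≡⟨ cong₂ (λ i j → vertexLabel w + label (toℕ i) j)
                                                                       (cycle-⊕ w d) (position-⊕-low w pw<d) ⟩
      label (toℕ (cycle w)) (position w)
        + label (toℕ (cycle w)) (position w + d)              ≡⟨ label-antipodal (toℕ<n (cycle w)) pw<d ⟩
      pred (M + M)                                            ∎
      where open ≡-Reasoning

    antipodal : ∀ w → vertexLabel w + vertexLabel (w ⊕ d) ≡ pred (M + M)
    antipodal w with position w <? d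
    ... | yes pw<d = antipodal-low w pw<d
    ... | no  pw≮d = begin
      vertexLabel w + vertexLabel (w ⊕ d)           ≡⟨ +-comm (vertexLabel w) _ ⟩
      vertexLabel (w ⊕ d) + vertexLabel w           ≡⟨ cong ((vertexLabel (w ⊕ d) +_) ∘ vertexLabel) (⊕-d-d w) ⟨
      vertexLabel (w ⊕ d) + vertexLabel (w ⊕ d ⊕ d) ≡⟨ antipodal-low (w ⊕ d) p[w⊕d]<d ⟩
      pred (M + M)                                  ∎
      where
      open ≡-Reasoning
      p[w⊕d]<d : position (w ⊕ d) < d
      p[w⊕d]<d = subst (_< d) (sym (position-⊕-high w (≮⇒≥ pw≮d)))
                   (high-half (≮⇒≥ pw≮d) (position<d+d w))

    labelling : V ⤖ V
    labelling = mk⤖ (injective , strictlySurjective⇒surjective (injective⇒surjective injective))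
      where
      injective : Injective _≡_ _≡_ (λ v → fromℕ< (vertexLabel< v))
      injective {v} {w} eq = vertexLabel-injective
        (trans (sym (toℕ-fromℕ< (vertexLabel< v))) (trans (cong toℕ eq) (toℕ-fromℕ< (vertexLabel< w))))

    labelling-isKDML : IsKDML G k labelling
    labelling-isKDML = suc (suc (pred (M + M))) , sphere-constant
      where
      f : V → ℕ
      f v = suc (toℕ (Bijection.to labelling v))
      f≡ : ∀ v → f v ≡ suc (vertexLabel v)
      f≡ v = cong suc (toℕ-fromℕ< (vertexLabel< v))
      sphere-constant : ∀ u → sphereSum G k f u ≡ suc (suc (pred (M + M)))
      sphere-constant u = begin
        sphereSum G k f u
          ≡⟨ sphereSum-pair 0<k (<⇒≤ 2k<n) f (⊕≢⊖ u 0<k 2k<n) ⟩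
        f (u ⊕ k) + f (u ⊖ k)
          ≡⟨ +-comm (f (u ⊕ k)) _ ⟩
        f (u ⊖ k) + f (u ⊕ k)
          ≡⟨ cong ((f (u ⊖ k) +_) ∘ f) u⊖k⊕d≡u⊕k ⟨
        f (u ⊖ k) + f (u ⊖ k ⊕ d)
          ≡⟨ cong₂ _+_ (f≡ (u ⊖ k)) (f≡ (u ⊖ k ⊕ d)) ⟩
        suc (vertexLabel (u ⊖ k)) + suc (vertexLabel (u ⊖ k ⊕ d))
          ≡⟨ cong suc (+-suc _ _) ⟩
        suc (suc (vertexLabel (u ⊖ k) + vertexLabel (u ⊖ k ⊕ d)))
          ≡⟨ cong (2 +_) (antipodal (u ⊖ k)) ⟩
        suc (suc (pred (M + M)))
          ∎
        where
        open ≡-Reasoning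
        2k<n : 2 * k < n (cycle u)
        2k<n = subst (d <_) (sym (n≡d+d (cycle u))) (m<m+n d (>-nonZero⁻¹ d))
        u⊖k⊕d≡u⊕k : u ⊖ k ⊕ d ≡ u ⊕ k
        u⊖k⊕d≡u⊕k = begin
          u ⊖ k ⊕ d       ≡⟨ cong (u ⊖ k ⊕_) (2*m≡m+m k) ⟩
          u ⊖ k ⊕ (k + k) ≡⟨ ⊕-assoc (u ⊖ k) k k ⟨
          u ⊖ k ⊕ k ⊕ k   ≡⟨ cong (_⊕ k) (⊖-⊕ u (≤-trans (m≤2*m k) (<⇒≤ 2k<n))) ⟩
          u ⊕ k           ∎

    n≡4k⇒isKDM : 1 ≤ m → IsKDM G k
    n≡4k⇒isKDM 1≤m = 3≤total , labelling , labelling-isKDML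
      where
      3≤total : 3 ≤ total m n
      3≤total = ≤-trans (n≤1+n 3)
        (subst (4 ≤_) (sym (total-constant m n n≡4k)) (*-mono-≤ 1≤m (*-monoʳ-≤ 4 0<k)))

theorem2p7 : (k : ℕ) → 2 ≤ k → (m : ℕ) → 1 ≤ m → (n : Fin m → ℕ) →
    (∀ i → 2 * k ≤ n i) →
    (IsKDM (unionOfCycles m n) k ⇔ (∀ i → n i ≡ 4 * k))
theorem2p7 k 2≤k m 1≤m n 2k≤n =
  mk⇔ (λ kDM i → isKDM⇒n≡4k 0<k kDM i (2k≤n i)) (λ n≡4k → n≡4k⇒isKDM 0<k n≡4k 1≤m)
  where
  0<k : 0 < k
  0<k = <-≤-trans z<s 2≤k
  instance
    n≢0 : ∀ {i} → NonZero (n i)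
    n≢0 {i} = >-nonZero (<-≤-trans (*-monoʳ-< 2 0<k) (2k≤n i))
  open UnionOfCycles m n
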